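{- Let $r_n$ be the starting position of the first occurrence of the word $1^n$ in $\mathbf{b}$. Then $r_n \geq 2 \uparrow\uparrow (n-1) + 3$ for all $n \geq 3$.
   Context: Define finite binary words $B_i$ by $B_1 = 101$ and $B_{i+1} = B_i C_i$ for $i \geq 1$, where $C_i$ is the word obtained from $B_i$ by removing its first $i$ symbols. Since each $B_i$ is a prefix of $B_{i+1}$, there is a unique infinite binary word $\mathbf{b}$ of which every $B_i$ is a prefix. Words are indexed starting at position $1$. Tetration: $a \uparrow\uparrow 0 = 1$ and $a \uparrow\uparrow n = a^{a \uparrow\uparrow (n-1)}$ for $n \geq 1$. -}

module Defs where

open import Data.Nat using (ℕ; zero; suc; _+_; _^_; _∸_; _<_)
open import Data.Bool using (Bool; true; false)
open import Data.List using (List; []; _∷_; _++_; drop)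
open import Relation.Binary.PropositionalEquality using (_≡_)

-- W k is the word B_{k+1} of the paper (so W 0 = B_1 = 101).
-- B_{i+1} = B_i C_i with C_i = B_i with its first i symbols removed;
-- in terms of W: W (suc k) = W k ++ drop (suc k) (W k).
W : ℕ → List Bool
W zero    = true ∷ false ∷ true ∷ []
W (suc k) = W k ++ drop (suc k) (W k)

-- 0-indexed lookup with default (never used in range, see below)
at : List Bool → ℕ → Bool
at []       _       = false
at (x ∷ xs) zero    = x
at (x ∷ xs) (suc n) = at xs n

-- The infinite word b, indexed from position 1.  Since |B_{k+1}| ≥ k + 3,
-- position p (1 ≤ p) lies inside W p, which is a prefix of b.
b : ℕ → Bool
b p = at (W p) (p ∸ 1)

_↑↑_ : ℕ → ℕ → ℕ
a ↑↑ zero  = 1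
a ↑↑ suc n = a ^ (a ↑↑ n)

Ones : ℕ → ℕ → Set
Ones n p = ∀ j → j < n → b (p + j) ≡ true

{-# OPTIONS --safe #-}
-- Here W k = B_{k+1} and L k = |W k| = (k + 1) + (2^k + 1). Since
-- W (k+1) = W k ++ drop (k+1) (W k), the letter of b at L k + 1 + m repeats the
-- one at k + 2 + m for m ≤ 2^k, and the penultimate letter of every W k is 0.
-- A run of ones starting at L k + 1 + m with m < 2^k cannot reach the copy of
-- that 0 at m = 2^k - 1, so it repeats a run starting earlier. A run of n ones
-- starting at the last letter of W (k+1) continues with n - 1 ones at the start
-- of the next copy, hence repeats a run of n - 1 ones at k + 3; by induction on
-- n, 2↑↑(n-2) ≤ k + 1, so the run starts at L (k+1) ≥ 2^(k+1) + 3 ≥ 2↑↑(n-1) + 3.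
module Submission where

open import Defs
open import Data.Nat using (ℕ; zero; suc; _+_; _∸_; _^_; _≤_; _<_; z≤n; s≤s; _≤?_)
open import Data.Nat.Properties
open import Data.Nat.Tactic.RingSolver using (solve-∀)
open import Data.Bool using (Bool; true; false)
open import Data.List using (List; []; _∷_; _++_; drop; length)
open import Data.List.Properties using (length-++; length-drop; ++-assoc; ++-identityʳ)
open import Data.Product using (∃; _×_; _,_)
open import Data.Sum using (inj₁; inj₂)
open import Relation.Nullary using (yes; no; contradiction)
open import Relation.Binary.PropositionalEquality
open ≡-Reasoning

at-++ˡ : ∀ xs ys {q} → q < length xs → at (xs ++ ys) q ≡ at xs q
at-++ˡ (x ∷ xs) ys {zero}  _         = refl
at-++ˡ (x ∷ xs) ys {suc q} (s≤s q<) = at-++ˡ xs ys q<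

at-++ʳ : ∀ xs ys m → at (xs ++ ys) (length xs + m) ≡ at ys m
at-++ʳ []       ys m = refl
at-++ʳ (x ∷ xs) ys m = at-++ʳ xs ys m

at-drop : ∀ n xs m → at (drop n xs) m ≡ at xs (n + m)
at-drop zero    xs       m = refl
at-drop (suc n) []       m = refl
at-drop (suc n) (x ∷ xs) m = at-drop n xs m

L : ℕ → ℕ
L k = suc k + suc (2 ^ k)

L-suc : ∀ k → L (suc k) ≡ suc (L k) + 2 ^ k
L-suc k = lemma k (2 ^ k)
  where
  lemma : ∀ k x → suc (suc k) + suc (x + (x + 0)) ≡ suc (suc k + suc x + x)
  lemma = solve-∀

n<L : ∀ n → n < L n
n<L n = m≤m+n (suc n) _

length-W : ∀ k → length (W k) ≡ L k
length-W zero    = refl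
length-W (suc k) = begin
  length (W k ++ drop (suc k) (W k))          ≡⟨ length-++ (W k) ⟩
  length (W k) + length (drop (suc k) (W k))  ≡⟨ cong (length (W k) +_) (length-drop (suc k) (W k)) ⟩
  length (W k) + (length (W k) ∸ suc k)       ≡⟨ cong (λ l → l + (l ∸ suc k)) (length-W k) ⟩
  L k + (L k ∸ suc k)                         ≡⟨ cong (L k +_) (m+n∸m≡n (suc k) (suc (2 ^ k))) ⟩
  L k + suc (2 ^ k)                           ≡⟨ +-suc (L k) (2 ^ k) ⟩
  suc (L k) + 2 ^ k                           ≡⟨ L-suc k ⟨
  L (suc k)                                   ∎

W-prefix : ∀ d k → ∃ λ ys → W (d + k) ≡ W k ++ ys
W-prefix zero    k = [] , sym (++-identityʳ (W k))
W-prefix (suc d) k with W-prefix d k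
... | ys , eq = ys ++ C , (begin
  W (d + k) ++ C    ≡⟨ cong (_++ C) eq ⟩
  (W k ++ ys) ++ C  ≡⟨ ++-assoc (W k) ys C ⟩
  W k ++ (ys ++ C)  ∎)
  where
  C : List Bool
  C = drop (suc (d + k)) (W (d + k))

at-W-prefix : ∀ d k {q} → q < L k → at (W (d + k)) q ≡ at (W k) q
at-W-prefix d k {q} q< with W-prefix d k
... | ys , eq = trans (cong (λ w → at w q) eq)
                      (at-++ˡ (W k) ys (subst (q <_) (sym (length-W k)) q<))

b-at-W : ∀ k {q} → q < L k → b (suc q) ≡ at (W k) q
b-at-W k {q} q< = begin
  b (suc q)             ≡⟨⟩
  at (W (suc q)) q      ≡⟨ at-W-prefix k (suc q) (<-trans (n<1+n q) (n<L (suc q))) ⟨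
  at (W (k + suc q)) q  ≡⟨ cong (λ i → at (W i) q) (+-comm k (suc q)) ⟩
  at (W (suc q + k)) q  ≡⟨ at-W-prefix (suc q) k q< ⟩
  at (W k) q            ∎

b-copy : ∀ k {m} → m ≤ 2 ^ k → b (suc (L k) + m) ≡ b (suc (suc k) + m)
b-copy k {m} m≤ = begin
  b (suc (L k) + m)                  ≡⟨ b-at-W (suc k) inside-W[k+1] ⟩
  at (W k ++ C) (L k + m)            ≡⟨ cong (λ l → at (W k ++ C) (l + m)) (length-W k) ⟨
  at (W k ++ C) (length (W k) + m)   ≡⟨ at-++ʳ (W k) C m ⟩
  at C m                             ≡⟨ at-drop (suc k) (W k) m ⟩
  at (W k) (suc k + m)               ≡⟨ b-at-W k (+-monoʳ-< (suc k) (s≤s m≤)) ⟨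
  b (suc (suc k + m))                ∎
  where
  C : List Bool
  C = drop (suc k) (W k)
  inside-W[k+1] : L k + m < L (suc k)
  inside-W[k+1] = subst (L k + m <_) (sym (L-suc k)) (s≤s (+-monoʳ-≤ (L k) m≤))

penultimate-W[k+1] : ∀ k {m} → suc m ≡ 2 ^ k → suc (L k) + m ≡ suc (suc k) + 2 ^ suc k
penultimate-W[k+1] k {m} eq = begin
  suc (L k) + m            ≡⟨ +-suc (L k) m ⟨
  L k + suc m              ≡⟨ cong (L k +_) eq ⟩
  L k + 2 ^ k              ≡⟨ lemma k (2 ^ k) ⟩
  suc (suc k) + 2 ^ suc k  ∎
  where
  lemma : ∀ k x → suc k + suc x + x ≡ suc (suc k) + (x + (x + 0))
  lemma = solve-∀

b-penultimate : ∀ k → b (suc k + 2 ^ k) ≡ false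
b-penultimate zero    = refl
b-penultimate (suc k) with m≤n⇒∃[o]m+o≡n (m^n>0 2 k)
... | t , eq = begin
  b (suc (suc k) + 2 ^ suc k)  ≡⟨ cong b (penultimate-W[k+1] k eq) ⟨
  b (suc (L k) + t)            ≡⟨ b-copy k (subst (t ≤_) eq (n≤1+n t)) ⟩
  b (suc (suc k) + t)          ≡⟨ cong (λ i → b (suc i)) (trans (sym (+-suc k t)) (cong (k +_) eq)) ⟩
  b (suc k + 2 ^ k)            ≡⟨ b-penultimate k ⟩
  false                        ∎

Ones-false⇒≤ : ∀ {n p d} → Ones n p → b (p + d) ≡ false → n ≤ d
Ones-false⇒≤ {d = d} ones gap = ≮⇒≥ (λ d<n → contradiction (trans (sym gap) (ones d d<n)) λ ())

Ones-suc : ∀ {n p} → Ones (suc n) p → Ones n (suc p)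
Ones-suc {p = p} ones j j<n = subst (λ i → b i ≡ true) (+-suc p j) (ones (suc j) (s≤s j<n))

Ones-copy : ∀ k {n m} → m < 2 ^ k → Ones n (suc (L k) + m) → Ones n (suc (suc k) + m)
Ones-copy k {n} {m} m< ones j j<n with m≤n⇒∃[o]m+o≡n m<
... | d , eq = begin
  b (suc (suc k) + m + j)    ≡⟨ cong b (+-assoc (suc (suc k)) m j) ⟩
  b (suc (suc k) + (m + j))  ≡⟨ b-copy k m+j≤ ⟨
  b (suc (L k) + (m + j))    ≡⟨ cong b (+-assoc (suc (L k)) m j) ⟨
  b (suc (L k) + m + j)      ≡⟨ ones j j<n ⟩
  true                       ∎
  where
  gap : b (suc (L k) + m + d) ≡ false
  gap = trans (cong b (trans (+-assoc (suc (L k)) m d) (penultimate-W[k+1] k eq)))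
              (b-penultimate (suc k))
  m+j≤ : m + j ≤ 2 ^ k
  m+j≤ = ≤-trans (+-monoʳ-≤ m (<⇒≤ (<-≤-trans j<n (Ones-false⇒≤ {p = suc (L k) + m} ones gap))))
                 (subst (m + d ≤_) eq (n≤1+n (m + d)))

Ones-after-W : ∀ k {n} → Ones (suc n) (L k) → Ones n (suc (suc k))
Ones-after-W k {n} ones =
  subst (Ones n) (+-identityʳ (suc (suc k)))
    (Ones-copy k (m^n>0 2 k) (subst (Ones n) (sym (+-identityʳ (suc (L k)))) (Ones-suc {p = L k} ones)))

block-offset : ∀ k {p} → L k < p → p ≤ L (suc k) → ∃ λ m → m ≤ 2 ^ k × suc (L k) + m ≡ p
block-offset k {p} L<p p≤ with m≤n⇒∃[o]m+o≡n L<p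
... | m , refl = m , +-cancelˡ-≤ (suc (L k)) m (2 ^ k) (subst (p ≤_) (L-suc k) p≤) , refl

2^+3≤L : ∀ k {m} → m ≤ suc k → 2 ^ m + 3 ≤ L (suc k)
2^+3≤L k m≤ = ≤-trans (+-monoˡ-≤ 3 (^-monoʳ-≤ 2 m≤))
                      (subst (_≤ L (suc k)) (+-comm 3 (2 ^ suc k)) (s≤s (s≤s (m≤n+m _ k))))

mutual
  ones⇒↑↑+3≤ : ∀ r k p → 1 ≤ p → p ≤ L k → Ones (2 + r) p → 2 ↑↑ suc r + 3 ≤ p
  ones⇒↑↑+3≤ r zero 1 _ _ ones = contradiction (ones 1 (s≤s (s≤s z≤n))) λ ()
  ones⇒↑↑+3≤ r zero 2 _ _ ones = contradiction (ones 0 (s≤s z≤n)) λ ()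
  ones⇒↑↑+3≤ r zero 3 _ _ ones = contradiction (ones 1 (s≤s (s≤s z≤n))) λ ()
  ones⇒↑↑+3≤ r zero (suc (suc (suc (suc _)))) _ (s≤s (s≤s (s≤s ()))) _
  ones⇒↑↑+3≤ r (suc k) p 1≤p p≤ ones with p ≤? L k
  ... | yes p≤L = ones⇒↑↑+3≤ r k p 1≤p p≤L ones
  ... | no p≰L with block-offset k (≰⇒> p≰L) p≤
  ...   | m , m≤ , refl with m≤n⇒m<n∨m≡n m≤
  ...     | inj₁ m< = ≤-trans (ones⇒↑↑+3≤ r k (suc (suc k) + m) (s≤s z≤n) copy≤L (Ones-copy k m< ones))
                             (+-monoˡ-≤ m (s≤s (n<L k)))
    where
    copy≤L : suc (suc k) + m ≤ L k
    copy≤L = subst (_≤ L k) (+-suc (suc k) m) (+-monoʳ-≤ (suc k) (s≤s (<⇒≤ m<)))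
  ...     | inj₂ refl = subst (2 ↑↑ suc r + 3 ≤_) (L-suc k) (2^+3≤L k tower≤)
    where
    tower≤ : 2 ↑↑ r ≤ suc k
    tower≤ = ones⇒↑↑≤ r k (Ones-after-W (suc k) (subst (Ones (2 + r)) (sym (L-suc k)) ones))

  ones⇒↑↑≤ : ∀ r k → Ones (suc r) (3 + k) → 2 ↑↑ r ≤ suc k
  ones⇒↑↑≤ zero    k _    = s≤s z≤n
  ones⇒↑↑≤ (suc r) k ones = m≤n⇒m≤1+n (+-cancelʳ-≤ 3 (2 ↑↑ suc r) k
    (subst (2 ↑↑ suc r + 3 ≤_) (+-comm 3 k) (ones⇒↑↑+3≤ r (3 + k) (3 + k) (s≤s z≤n) (<⇒≤ (n<L (3 + k))) ones)))

corollary5 : ∀ (n p : ℕ) → 3 ≤ n → 1 ≤ p → Ones n p → (2 ↑↑ (n ∸ 1)) + 3 ≤ p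
corollary5 (suc zero)    p (s≤s ()) _ _
corollary5 (suc (suc r)) p _ 1≤p ones = ones⇒↑↑+3≤ r p p 1≤p (<⇒≤ (n<L p)) ones
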